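{- Fix an integer $d\geq 1$. Every Stabbing Planes refutation of $\mathrm{PHP}^{n+d}_n$ has depth $\Omega(\log n)$.
   Context: $\mathrm{PHP}^m_n$ ($m>n$) is the set of integer linear inequalities over variables $P_{i,j}$, $i\in[m]$, $j\in[n]$: $\sum_{j=1}^n P_{i,j}\geq 1$ for all $i\in[m]$, and $P_{i,k}+P_{j,k}\leq 1$ for all $k\in[n]$ and $i\neq j\in[m]$. A Stabbing Planes (SP) refutation of an unsatisfiable set $\mathcal{F}$ of integer linear inequalities in variables $x_1,\dots,x_N$ is a binary tree in which each internal node is labelled by a query $(\mathbf a,b)$ with $\mathbf a\in\mathbb Z^N$, $b\in\mathbb Z$, its two outgoing edges being labelled $\mathbf a\mathbf x\geq b$ and $\mathbf a\mathbf x\leq b-1$, such that for every leaf the linear program consisting of $\mathcal{F}$ together with the inequalities on the edges of the root-to-leaf path is infeasible over $\mathbb R$. Its depth is the length of the longest root-to-leaf path. -}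

module Defs where

open import Data.Nat as ℕ using (ℕ; zero; suc)
open import Data.Integer as ℤ using (ℤ; +_)
open import Data.Rational as ℚ using (ℚ; _/_)
open import Data.Fin as Fin using (Fin; combine; quotient)
open import Data.Bool using (Bool; if_then_else_)
open import Data.Product using (Σ; ∃; _×_; _,_)
open import Data.Sum using (_⊎_)
open import Data.List using (List; []; _∷_)
open import Data.List.Relation.Unary.All using (All)
open import Relation.Nullary using (¬_)
open import Relation.Nullary.Decidable using (⌊_⌋)
open import Relation.Binary.PropositionalEquality using (_≢_)

record Ineq (N : ℕ) : Set where
  constructor _≥[_]
  field
    coeffs : Fin N → ℤ
    bound  : ℤ
open Ineq public

ι : ℤ → ℚ
ι z = z / 1

sumℚ : ∀ {N} → (Fin N → ℚ) → ℚ
sumℚ {zero}  f = ℚ.0ℚ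
sumℚ {suc N} f = f Fin.zero ℚ.+ sumℚ (λ v → f (Fin.suc v))

Sat : ∀ {N} → (Fin N → ℚ) → Ineq N → Set
Sat x (a ≥[ b ]) = ι b ℚ.≤ sumℚ (λ v → ι (a v) ℚ.* x v)

record System (N : ℕ) : Set₁ where
  field
    Idx  : Set
    ineq : Idx → Ineq N
open System public

-- Real (here: rational) LP feasibility of a system together with extra
-- path inequalities.
Feasible : ∀ {N} → System N → List (Ineq N) → Set
Feasible F Γ = ∃ λ (x : Fin _ → ℚ) → ((i : Idx F) → Sat x (ineq F i)) × All (Sat x) Γ

data SPTree (N : ℕ) : Set where
  leaf : SPTree N
  -- query (a , b): left edge  a x ≥ b,  right edge  a x ≤ b - 1
  node : (a : Fin N → ℤ) (b : ℤ) → SPTree N → SPTree N → SPTree N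

depth : ∀ {N} → SPTree N → ℕ
depth leaf           = 0
depth (node _ _ l r) = suc (depth l ℕ.⊔ depth r)

-- a x ≤ b - 1   written as   (-a) x ≥ 1 - b
negIneq : ∀ {N} → (Fin N → ℤ) → ℤ → Ineq N
negIneq a b = (λ v → ℤ.- a v) ≥[ + 1 ℤ.- b ]

RefutesFrom : ∀ {N} → System N → List (Ineq N) → SPTree N → Set
RefutesFrom F Γ leaf = ¬ Feasible F Γ
RefutesFrom F Γ (node a b l r) =
  RefutesFrom F ((a ≥[ b ]) ∷ Γ) l × RefutesFrom F (negIneq a b ∷ Γ) r

IsSPRefutation : ∀ {N} → System N → SPTree N → Set
IsSPRefutation F T = RefutesFrom F [] T

-- Pigeonhole principle PHP^m_n; variable P_{i,j} is  combine i j : Fin (m * n)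

indicator : Bool → ℤ
indicator b = if b then + 1 else + 0

-- Σ_j P_{i,j} ≥ 1
pigeonIneq : ∀ m n → Fin m → Ineq (m ℕ.* n)
pigeonIneq m n i = (λ v → indicator ⌊ quotient {m} n v Fin.≟ i ⌋) ≥[ + 1 ]

-- P_{i,k} + P_{j,k} ≤ 1, written as  -P_{i,k} - P_{j,k} ≥ -1
holeIneq : ∀ m n → Fin n → Fin m → Fin m → Ineq (m ℕ.* n)
holeIneq m n k i j =
  (λ v → ℤ.- indicator ⌊ v Fin.≟ combine i k ⌋ ℤ.- indicator ⌊ v Fin.≟ combine j k ⌋)
  ≥[ ℤ.- (+ 1) ]

PHPIdx : ℕ → ℕ → Set
PHPIdx m n = Fin m ⊎ (Σ (Fin n) λ k → Σ (Fin m) λ i → Σ (Fin m) λ j → i ≢ j)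

PHP : ∀ m n → System (m ℕ.* n)
PHP m n = record { Idx = PHPIdx m n ; ineq = go }
  where
  go : PHPIdx m n → Ineq (m ℕ.* n)
  go (Data.Sum.inj₁ i) = pigeonIneq m n i
  go (Data.Sum.inj₂ (k , i , j , _)) = holeIneq m n k i j

-- Every half-integral point giving each pigeon weight ½ on two distinct holes satisfies
-- the LP relaxation: pigeon inequalities hold with equality, and P_{i,k} + P_{j,k} ≤ 1
-- because each term is at most ½.  An adversary descends the tree keeping, for each
-- pigeon i, a set C i of at least 2^(t+1) holes, t the remaining depth, such that every
-- such point supported on the sets satisfies the path so far.  At a query (a, b) it takes
-- for each pigeon a median θ i of the values a(i,h), h ∈ C i, follows a·x ≥ b when
-- b ≤ Σ θ i and a·x ≤ b - 1 otherwise, and keeps the holes on the corresponding side of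
-- each median: this at most halves the sets and enforces the new inequality.  Hence a
-- refutation of depth t has 2^(t+1) > n.
module Submission where

open import Defs
open import Data.Nat as ℕ using (ℕ; zero; suc; _^_; z≤n; s≤s; _⊔_)
import Data.Nat.Properties as ℕP
open import Data.Nat.Logarithm using (⌊log₂_⌋; ⌊log₂⌋-mono-≤; ⌊log₂[2^n]⌋≡n)
open import Data.Integer as ℤ using (ℤ; +_; 0ℤ; 1ℤ; _+_; _*_; -_; _-_; _≤_; _≤?_)
import Data.Integer.Properties as ℤP
open import Data.Integer.Tactic.RingSolver using (solve-∀)
open import Algebra.Properties.Semiring.Sum ℤP.+-*-semiring
  using (sum; sum-syntax; sum-remove; sum-cong-≗; sum-replicate-zero; ∑-distrib-+; ∑-comm; *-distribˡ-sum)
open import Data.Rational as ℚ using (ℚ)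
import Data.Rational.Properties as ℚP
open import Data.Rational.Unnormalised as ℚᵘ using (mkℚᵘ; *≡*; *≤*; _≃_)
import Data.Rational.Unnormalised.Properties as ℚᵘP
open import Data.Fin as Fin using (Fin; zero; suc; combine; punchIn)
import Data.Fin.Properties as FinP
open import Data.List using (List; []; _∷_; length; filter; map; allFin)
import Data.List.Properties as ListP
open import Data.List.Relation.Unary.All as All using (All; []; _∷_)
import Data.List.Relation.Unary.All.Properties as AllP
open import Data.List.Relation.Unary.AllPairs using (_∷_)
open import Data.List.Relation.Unary.Any using (here; there)
open import Data.List.Relation.Unary.Unique.Propositional using (Unique)
import Data.List.Relation.Unary.Unique.Propositional.Properties as UniqueP
open import Data.List.Membership.Propositional using (_∈_)
open import Data.List.Membership.Propositional.Properties using (∈-filter⁻)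
open import Data.List.Extrema ℤP.≤-totalOrder using (min; max; min≤⊤; min≤xs; ⊥≤max; xs≤max)
open import Data.Product using (∃-syntax; ∃₂; _×_; _,_; proj₁; proj₂)
open import Data.Sum using (_⊎_; inj₁; inj₂; [_,_]′)
open import Function using (_∘_; case_of_)
open import Relation.Nullary using (¬_; Dec; yes; no; contradiction)
open import Relation.Nullary.Decidable using (⌊_⌋)
open import Relation.Unary using (Decidable)
open import Relation.Binary.PropositionalEquality

-- Finite integer sums

∑-mono-≤ : ∀ {N} {f g : Fin N → ℤ} → (∀ v → f v ≤ g v) → sum f ≤ sum g
∑-mono-≤ {zero}  _   = ℤP.≤-refl
∑-mono-≤ {suc N} f≤g = ℤP.+-mono-≤ (f≤g zero) (∑-mono-≤ (f≤g ∘ suc))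

∑-neg : ∀ {N} (f : Fin N → ℤ) → ∑[ v < N ] (- f v) ≡ - sum f
∑-neg {zero}  f = refl
∑-neg {suc N} f = trans (cong (_+_ (- f zero)) (∑-neg (f ∘ suc)))
                        (sym (ℤP.neg-distrib-+ (f zero) _))

∑-single : ∀ {N} (f : Fin N → ℤ) u → (∀ v → v ≢ u → f v ≡ 0ℤ) → sum f ≡ f u
∑-single {suc N} f u vanish = begin
  sum f                                  ≡⟨ sum-remove {i = u} f ⟩
  f u + sum (f ∘ punchIn u)              ≡⟨ cong (_+_ (f u)) (sum-cong-≗ (λ v → vanish _ (FinP.punchInᵢ≢i u v))) ⟩
  f u + sum (λ (_ : Fin N) → 0ℤ)         ≡⟨ cong (_+_ (f u)) (sum-replicate-zero N) ⟩
  f u + 0ℤ                               ≡⟨ ℤP.+-identityʳ (f u) ⟩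
  f u                                    ∎
  where open ≡-Reasoning

δ : ∀ {N} → Fin N → Fin N → ℤ
δ u v = indicator ⌊ v Fin.≟ u ⌋

δ-diag : ∀ {N} (u : Fin N) → δ u u ≡ 1ℤ
δ-diag u with u Fin.≟ u
... | yes _   = refl
... | no u≢u = contradiction refl u≢u

δ-off : ∀ {N} {u v : Fin N} → v ≢ u → δ u v ≡ 0ℤ
δ-off {u = u} {v} v≢u with v Fin.≟ u
... | yes v≡u = contradiction v≡u v≢u
... | no _    = refl

∑-*-δ : ∀ {N} (f : Fin N → ℤ) u → ∑[ v < N ] (f v * δ u v) ≡ f u
∑-*-δ f u = begin
  ∑[ v < _ ] (f v * δ u v)  ≡⟨ ∑-single _ u (λ v v≢u → trans (cong (f v *_) (δ-off v≢u)) (ℤP.*-zeroʳ (f v))) ⟩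
  f u * δ u u             ≡⟨ cong (f u *_) (δ-diag u) ⟩
  f u * 1ℤ                ≡⟨ ℤP.*-identityʳ (f u) ⟩
  f u                     ∎
  where open ≡-Reasoning

indicator-disjoint : ∀ {A B : Set} (a? : Dec A) (b? : Dec B) → ¬ (A × B) →
                     indicator ⌊ a? ⌋ + indicator ⌊ b? ⌋ ≤ 1ℤ
indicator-disjoint (yes a) (yes b) ¬ab = contradiction (a , b) ¬ab
indicator-disjoint (yes _) (no _)  _   = ℤP.≤-refl
indicator-disjoint (no _)  (yes _) _   = ℤP.≤-refl
indicator-disjoint (no _)  (no _)  _   = ℤ.+≤+ z≤n

-- Half-integral rational points

-- mkℚᵘ z 1 is z/2: the second field of mkℚᵘ is the denominator minus one.
half : ℤ → ℚ
half z = ℚ.fromℚᵘ (mkℚᵘ z 1)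

toℚᵘ-ι*half : ∀ a w → ℚ.toℚᵘ (ι a ℚ.* half w) ≃ mkℚᵘ (a * w) 1
toℚᵘ-ι*half a w = ℚᵘP.≃-trans (ℚP.toℚᵘ-homo-* (ι a) (half w))
  (ℚᵘP.*-cong (ℚP.toℚᵘ-fromℚᵘ (mkℚᵘ a 0)) (ℚP.toℚᵘ-fromℚᵘ (mkℚᵘ w 1)))

halves-+ : ∀ x y → mkℚᵘ x 1 ℚᵘ.+ mkℚᵘ y 1 ≃ mkℚᵘ (x + y) 1
halves-+ x y = *≡* (identity x y)
  where
  identity : ∀ x y → (x * + 2 + y * + 2) * + 2 ≡ (x + y) * + 4
  identity = solve-∀

toℚᵘ-sumℚ-ι*half : ∀ {N} (a w : Fin N → ℤ) →
  ℚ.toℚᵘ (sumℚ (λ v → ι (a v) ℚ.* half (w v))) ≃ mkℚᵘ (∑[ v < N ] (a v * w v)) 1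
toℚᵘ-sumℚ-ι*half {zero}  a w = *≡* refl
toℚᵘ-sumℚ-ι*half {suc N} a w = begin-equality
  ℚ.toℚᵘ (sumℚ (λ v → ι (a v) ℚ.* half (w v)))
    ≃⟨ ℚP.toℚᵘ-homo-+ (ι (a zero) ℚ.* half (w zero)) _ ⟩
  ℚ.toℚᵘ (ι (a zero) ℚ.* half (w zero)) ℚᵘ.+ ℚ.toℚᵘ (sumℚ (λ v → ι (a (suc v)) ℚ.* half (w (suc v))))
    ≃⟨ ℚᵘP.+-cong (toℚᵘ-ι*half (a zero) (w zero)) (toℚᵘ-sumℚ-ι*half (a ∘ suc) (w ∘ suc)) ⟩
  mkℚᵘ (a zero * w zero) 1 ℚᵘ.+ mkℚᵘ (∑[ v < N ] (a (suc v) * w (suc v))) 1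
    ≃⟨ halves-+ (a zero * w zero) (∑[ v < N ] (a (suc v) * w (suc v))) ⟩
  mkℚᵘ (∑[ v < suc N ] (a v * w v)) 1 ∎
  where open ℚᵘP.≤-Reasoning

Sat-half : ∀ {N} (a w : Fin N → ℤ) b → b * + 2 ≤ ∑[ v < N ] (a v * w v) → Sat (half ∘ w) (a ≥[ b ])
Sat-half a w b 2b≤a·w = ℚP.toℚᵘ-cancel-≤ (begin
  ℚ.toℚᵘ (ι b)                                     ≃⟨ ℚP.toℚᵘ-fromℚᵘ (mkℚᵘ b 0) ⟩
  mkℚᵘ b 0                                         ≤⟨ *≤* (subst (b * + 2 ≤_) (sym (ℤP.*-identityʳ _)) 2b≤a·w) ⟩
  mkℚᵘ (∑[ v < _ ] (a v * w v)) 1                  ≃⟨ ℚᵘP.≃-sym (toℚᵘ-sumℚ-ι*half a w) ⟩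
  ℚ.toℚᵘ (sumℚ (λ v → ι (a v) ℚ.* half (w v)))     ∎)
  where open ℚᵘP.≤-Reasoning

-- Pair points of the pigeonhole system

-- Pigeon i puts weight ½ on holes h₁ i and h₂ i; weight is twice the point.
module PairPoint {m n : ℕ} (h₁ h₂ : Fin m → Fin n) where

  weight : Fin (m ℕ.* n) → ℤ
  weight v = ∑[ i < m ] (δ (combine i (h₁ i)) v + δ (combine i (h₂ i)) v)

  point : Fin (m ℕ.* n) → ℚ
  point = half ∘ weight

  pairValue : (Fin (m ℕ.* n) → ℤ) → ℤ
  pairValue a = ∑[ i < m ] (a (combine i (h₁ i)) + a (combine i (h₂ i)))

  ∑-*-weight : ∀ a → ∑[ v < m ℕ.* n ] (a v * weight v) ≡ pairValue a
  ∑-*-weight a = begin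
    ∑[ v < m ℕ.* n ] (a v * weight v)
      ≡⟨ sum-cong-≗ (λ v → *-distribˡ-sum (a v) (λ i → δ (u₁ i) v + δ (u₂ i) v)) ⟩
    ∑[ v < m ℕ.* n ] ∑[ i < m ] (a v * (δ (u₁ i) v + δ (u₂ i) v))
      ≡⟨ ∑-comm (λ v i → a v * (δ (u₁ i) v + δ (u₂ i) v)) ⟩
    ∑[ i < m ] ∑[ v < m ℕ.* n ] (a v * (δ (u₁ i) v + δ (u₂ i) v))
      ≡⟨ sum-cong-≗ (λ i → sifts (u₁ i) (u₂ i)) ⟩
    pairValue a ∎
    where
    open ≡-Reasoning
    u₁ u₂ : Fin m → Fin (m ℕ.* n)
    u₁ i = combine i (h₁ i)
    u₂ i = combine i (h₂ i)
    sifts : ∀ x y → ∑[ v < m ℕ.* n ] (a v * (δ x v + δ y v)) ≡ a x + a y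
    sifts x y = begin
      ∑[ v < m ℕ.* n ] (a v * (δ x v + δ y v))      ≡⟨ sum-cong-≗ (λ v → ℤP.*-distribˡ-+ (a v) (δ x v) (δ y v)) ⟩
      ∑[ v < m ℕ.* n ] (a v * δ x v + a v * δ y v)  ≡⟨ ∑-distrib-+ (λ v → a v * δ x v) (λ v → a v * δ y v) ⟩
      ∑[ v < m ℕ.* n ] (a v * δ x v) + ∑[ v < m ℕ.* n ] (a v * δ y v)  ≡⟨ cong₂ _+_ (∑-*-δ a x) (∑-*-δ a y) ⟩
      a x + a y                                      ∎

  Sat-point : ∀ a c → c * + 2 ≤ pairValue a → Sat point (a ≥[ c ])
  Sat-point a c 2c≤ = Sat-half a weight c (subst (c * + 2 ≤_) (sym (∑-*-weight a)) 2c≤)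

  Sat-point-above : ∀ a c (θ : Fin m → ℤ) → c ≤ sum θ →
    (∀ i → θ i ≤ a (combine i (h₁ i))) → (∀ i → θ i ≤ a (combine i (h₂ i))) → Sat point (a ≥[ c ])
  Sat-point-above a c θ c≤Θ θ≤a₁ θ≤a₂ = Sat-point a c (begin
    c * + 2                   ≤⟨ ℤP.*-monoʳ-≤-nonNeg (+ 2) c≤Θ ⟩
    sum θ * + 2               ≡⟨ double (sum θ) ⟩
    sum θ + sum θ             ≡⟨ ∑-distrib-+ θ θ ⟨
    ∑[ i < m ] (θ i + θ i)    ≤⟨ ∑-mono-≤ (λ i → ℤP.+-mono-≤ (θ≤a₁ i) (θ≤a₂ i)) ⟩
    pairValue a               ∎)
    where
    open ℤP.≤-Reasoning
    double : ∀ x → x * + 2 ≡ x + x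
    double = solve-∀

  Sat-point-pigeon : ∀ i → Sat point (pigeonIneq m n i)
  Sat-point-pigeon i = Sat-point q (+ 1) (ℤP.≤-reflexive (sym (begin
    pairValue q                   ≡⟨ sum-cong-≗ (λ j → cong₂ _+_ (q-combine j (h₁ j)) (q-combine j (h₂ j))) ⟩
    ∑[ j < m ] (δ i j + δ i j)    ≡⟨ ∑-single _ i (λ j j≢i → cong₂ _+_ (δ-off j≢i) (δ-off j≢i)) ⟩
    δ i i + δ i i                 ≡⟨ cong₂ _+_ (δ-diag i) (δ-diag i) ⟩
    + 2                           ∎)))
    where
    open ≡-Reasoning
    q : Fin (m ℕ.* n) → ℤ
    q = coeffs (pigeonIneq m n i)
    q-combine : ∀ j h → q (combine j h) ≡ δ i j
    q-combine j h = cong (δ i ∘ proj₁) (FinP.remQuot-combine j h)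

  module _ (h₁≢h₂ : ∀ i → h₁ i ≢ h₂ i) where

    weight≤1 : ∀ i k → weight (combine i k) ≤ 1ℤ
    weight≤1 i k = begin
      weight (combine i k)
        ≡⟨ ∑-single _ i (λ l l≢i → cong₂ _+_ (δ-off (other-pigeon l≢i)) (δ-off (other-pigeon l≢i))) ⟩
      δ (combine i (h₁ i)) (combine i k) + δ (combine i (h₂ i)) (combine i k)
        ≤⟨ indicator-disjoint (combine i k Fin.≟ combine i (h₁ i)) (combine i k Fin.≟ combine i (h₂ i))
             (λ (k≡h₁ , k≡h₂) → h₁≢h₂ i (trans (sym (FinP.combine-injectiveʳ i k i _ k≡h₁))
                                                (FinP.combine-injectiveʳ i k i _ k≡h₂))) ⟩
      1ℤ ∎
      where
      open ℤP.≤-Reasoning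
      other-pigeon : ∀ {l h} → l ≢ i → combine i k ≢ combine l h
      other-pigeon l≢i eq = l≢i (sym (FinP.combine-injectiveˡ i k _ _ eq))

    Sat-point-hole : ∀ k i j → Sat point (holeIneq m n k i j)
    Sat-point-hole k i j = Sat-half (coeffs (holeIneq m n k i j)) weight (- 1ℤ) (begin
      - 1ℤ * + 2                                  ≡⟨⟩
      - 1ℤ + - 1ℤ                                 ≤⟨ ℤP.+-mono-≤ (ℤP.neg-mono-≤ (weight≤1 i k)) (ℤP.neg-mono-≤ (weight≤1 j k)) ⟩
      - weight u₁ + - weight u₂                   ≡⟨ cong₂ _+_ (∑-*-δ (-_ ∘ weight) u₁) (∑-*-δ (-_ ∘ weight) u₂) ⟨
      ∑[ v < m ℕ.* n ] (- weight v * δ u₁ v) + ∑[ v < m ℕ.* n ] (- weight v * δ u₂ v)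
                                                  ≡⟨ ∑-distrib-+ (λ v → - weight v * δ u₁ v) (λ v → - weight v * δ u₂ v) ⟨
      ∑[ v < m ℕ.* n ] (- weight v * δ u₁ v + - weight v * δ u₂ v)
                                                  ≡⟨ sum-cong-≗ (λ v → rearrange (δ u₁ v) (δ u₂ v) (weight v)) ⟩
      ∑[ v < m ℕ.* n ] ((- δ u₁ v - δ u₂ v) * weight v) ∎)
      where
      open ℤP.≤-Reasoning
      u₁ u₂ : Fin (m ℕ.* n)
      u₁ = combine i k
      u₂ = combine j k
      rearrange : ∀ x y w → - w * x + - w * y ≡ (- x - y) * w
      rearrange = solve-∀

    point-satisfies-PHP : ∀ ix → Sat point (ineq (PHP m n) ix)
    point-satisfies-PHP (inj₁ i)               = Sat-point-pigeon i
    point-satisfies-PHP (inj₂ (k , i , j , _)) = Sat-point-hole k i j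

-- Splitting a list at a median

crossing : ∀ {P : ℤ → Set} → Decidable P → ∀ {lo hi} → lo ≤ hi → ¬ P lo → P hi →
           ∃[ θ ] ¬ P θ × P (ℤ.suc θ)
crossing {P} P? {lo} {hi} lo≤hi ¬Plo Phi = walk ℤ.∣ hi - lo ∣ (subst P (sym lo+∣hi-lo∣≡hi) Phi)
  where
  lo+∣hi-lo∣≡hi : lo + + ℤ.∣ hi - lo ∣ ≡ hi
  lo+∣hi-lo∣≡hi = begin
    lo + + ℤ.∣ hi - lo ∣  ≡⟨ cong (_+_ lo) (ℤP.0≤i⇒+∣i∣≡i (ℤP.i≤j⇒0≤j-i lo≤hi)) ⟩
    lo + (hi - lo)        ≡⟨ cancel lo hi ⟩
    hi                    ∎
    where
    open ≡-Reasoning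
    cancel : ∀ x y → x + (y - x) ≡ y
    cancel = solve-∀
  walk : ∀ k → P (lo + + k) → ∃[ θ ] ¬ P θ × P (ℤ.suc θ)
  walk zero    P[lo+0]   = contradiction (subst P (ℤP.+-identityʳ lo) P[lo+0]) ¬Plo
  walk (suc k) P[lo+1+k] with P? (lo + + k)
  ... | yes P[lo+k] = walk k P[lo+k]
  ... | no ¬P[lo+k] = lo + + k , ¬P[lo+k] , subst P (shift lo (+ k)) P[lo+1+k]
    where
    shift : ∀ x y → x + (1ℤ + y) ≡ 1ℤ + (x + y)
    shift = solve-∀

length≤filter+filter : ∀ {A : Set} {P Q : A → Set} (P? : Decidable P) (Q? : Decidable Q) →
  (∀ x → P x ⊎ Q x) → ∀ xs → length xs ℕ.≤ length (filter P? xs) ℕ.+ length (filter Q? xs)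
length≤filter+filter P? Q? cover [] = z≤n
length≤filter+filter P? Q? cover (x ∷ xs)
  with ih ← length≤filter+filter P? Q? cover xs | P? x | Q? x
... | yes _ | yes _ = s≤s (ℕP.≤-trans ih (ℕP.+-monoʳ-≤ _ (ℕP.n≤1+n _)))
... | yes _ | no _  = s≤s ih
... | no _  | yes _ = ℕP.≤-trans (s≤s ih) (ℕP.≤-reflexive (sym (ℕP.+-suc _ _)))
... | no ¬p | no ¬q = contradiction (cover x) [ ¬p , ¬q ]′

module _ {A : Set} (f : A → ℤ) where

  atMost atLeast : ℤ → List A → List A
  atMost  θ = filter (λ x → f x ≤? θ)
  atLeast θ = filter (λ x → θ ≤? f x)

  below-all above-all : List A → ℤ
  below-all xs = ℤ.pred (min 0ℤ (map f xs))
  above-all xs = max 0ℤ (map f xs)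

  below-all≤above-all : ∀ xs → below-all xs ≤ above-all xs
  below-all≤above-all xs = ℤP.≤-trans (ℤP.i≤j⇒pred[i]≤j (min≤⊤ 0ℤ (map f xs))) (⊥≤max 0ℤ (map f xs))

  atMost-below-all : ∀ xs → atMost (below-all xs) xs ≡ []
  atMost-below-all xs = ListP.filter-none (λ x → f x ≤? below-all xs)
    (All.map (λ min≤fx fx≤pred[min] → ℤP.≤⇒≯ min≤fx (ℤP.i≤pred[j]⇒i<j fx≤pred[min]))
             (AllP.map⁻ (min≤xs 0ℤ (map f xs))))

  atMost-above-all : ∀ xs → atMost (above-all xs) xs ≡ xs
  atMost-above-all xs = ListP.filter-all (λ x → f x ≤? above-all xs) (AllP.map⁻ (xs≤max 0ℤ (map f xs)))

  -- θ can be taken to be the least integer with at least k values of f at most θ.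
  median-split : ∀ k → 1 ℕ.≤ k → ∀ xs → 2 ℕ.* k ℕ.≤ length xs →
    ∃[ θ ] k ℕ.≤ length (atMost θ xs) × k ℕ.≤ length (atLeast θ xs)
  median-split k 1≤k xs 2k≤∣xs∣
    with crossing (λ θ → k ℕ.≤? length (atMost θ xs)) (below-all≤above-all xs)
                  (λ k≤∣atMost∣ → case ℕP.≤-trans 1≤k (subst (k ℕ.≤_) (cong length (atMost-below-all xs)) k≤∣atMost∣) of λ ())
                  (subst (k ℕ.≤_) (sym (cong length (atMost-above-all xs))) (ℕP.≤-trans (ℕP.m≤n*m k 2) 2k≤∣xs∣))
  ... | θ , k≰∣atMostθ∣ , k≤∣atMost[1+θ]∣ =
    ℤ.suc θ , k≤∣atMost[1+θ]∣ ,
    ℕP.+-cancelˡ-≤ k k _ (begin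
      k ℕ.+ k                                                 ≡⟨ cong (k ℕ.+_) (ℕP.+-identityʳ k) ⟨
      2 ℕ.* k                                                 ≤⟨ 2k≤∣xs∣ ⟩
      length xs                                               ≤⟨ length≤filter+filter _ _ cover xs ⟩
      length (atMost θ xs) ℕ.+ length (atLeast (ℤ.suc θ) xs)  ≤⟨ ℕP.+-monoˡ-≤ _ (ℕP.<⇒≤ (ℕP.≰⇒> k≰∣atMostθ∣)) ⟩
      k ℕ.+ length (atLeast (ℤ.suc θ) xs)                     ∎)
    where
    open ℕP.≤-Reasoning
    cover : ∀ x → f x ≤ θ ⊎ ℤ.suc θ ≤ f x
    cover x with f x ≤? θ
    ... | yes fx≤θ = inj₁ fx≤θ
    ... | no  fx≰θ = inj₂ (ℤP.i<j⇒suc[i]≤j (ℤP.≰⇒> fx≰θ))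

-- The adversary

two-distinct : ∀ {A : Set} {xs : List A} → Unique xs → 2 ℕ.≤ length xs →
               ∃₂ λ x y → x ∈ xs × y ∈ xs × x ≢ y
two-distinct {xs = x ∷ y ∷ _} ((x≢y ∷ _) ∷ _) _ = x , y , here refl , there (here refl) , x≢y
two-distinct {xs = _ ∷ []} _ (s≤s ())

module _ {m n : ℕ} where
  open PairPoint

  row : (Fin (m ℕ.* n) → ℤ) → Fin m → Fin n → ℤ
  row a i h = a (combine i h)

  PairPointsSatisfy : (Fin m → List (Fin n)) → List (Ineq (m ℕ.* n)) → Set
  PairPointsSatisfy C Γ = ∀ h₁ h₂ → (∀ i → h₁ i ∈ C i) → (∀ i → h₂ i ∈ C i) → All (Sat (point h₁ h₂)) Γ

  PairPointsSatisfy-filter : ∀ {P : Fin m → Fin n → Set} (P? : ∀ i → Decidable (P i)) {C Γ} q →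
    (∀ h₁ h₂ → (∀ i → P i (h₁ i)) → (∀ i → P i (h₂ i)) → Sat (point h₁ h₂) q) →
    PairPointsSatisfy C Γ → PairPointsSatisfy (λ i → filter (P? i) (C i)) (q ∷ Γ)
  PairPointsSatisfy-filter {P} P? {C} q sat-q satΓ h₁ h₂ h₁∈ h₂∈ =
    sat-q h₁ h₂ (proj₂ ∘ kept h₁ h₁∈) (proj₂ ∘ kept h₂ h₂∈) ∷ satΓ h₁ h₂ (proj₁ ∘ kept h₁ h₁∈) (proj₁ ∘ kept h₂ h₂∈)
    where
    kept : ∀ h → (∀ i → h i ∈ filter (P? i) (C i)) → ∀ i → h i ∈ C i × P i (h i)
    kept h h∈ i = ∈-filter⁻ (P? i) {xs = C i} (h∈ i)

  pairPoint-feasible : ∀ {Γ} C → (∀ i → Unique (C i)) → (∀ i → 2 ℕ.≤ length (C i)) →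
    PairPointsSatisfy C Γ → Feasible (PHP m n) Γ
  pairPoint-feasible C unique big satΓ =
    point h₁ h₂ , point-satisfies-PHP h₁ h₂ h₁≢h₂ , satΓ h₁ h₂ h₁∈ h₂∈
    where
    pair : ∀ i → ∃₂ λ x y → x ∈ C i × y ∈ C i × x ≢ y
    pair i = two-distinct (unique i) (big i)
    h₁ h₂ : Fin m → Fin n
    h₁ i = proj₁ (pair i)
    h₂ i = proj₁ (proj₂ (pair i))
    h₁∈ : ∀ i → h₁ i ∈ C i
    h₁∈ i = proj₁ (proj₂ (proj₂ (pair i)))
    h₂∈ : ∀ i → h₂ i ∈ C i
    h₂∈ i = proj₁ (proj₂ (proj₂ (proj₂ (pair i))))
    h₁≢h₂ : ∀ i → h₁ i ≢ h₂ i
    h₁≢h₂ i = proj₂ (proj₂ (proj₂ (proj₂ (pair i))))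

  pairPoints-survive : ∀ T {Γ} C → (∀ i → Unique (C i)) → (∀ i → 2 ^ suc (depth T) ℕ.≤ length (C i)) →
    PairPointsSatisfy C Γ → ¬ RefutesFrom (PHP m n) Γ T
  pairPoints-survive leaf C unique big satΓ infeasible =
    infeasible (pairPoint-feasible C unique big satΓ)
  pairPoints-survive (node a b l r) C unique big satΓ (refutesˡ , refutesʳ) = case b ≤? sum θ of λ where
      (yes b≤Θ) → pairPoints-survive l (λ i → atLeast (row a i) (θ i) (C i))
        (λ i → UniqueP.filter⁺ _ (unique i))
        (λ i → ℕP.≤-trans (size-mono (ℕP.m≤m⊔n (depth l) (depth r))) (proj₂ (proj₂ (split i))))
        (PairPointsSatisfy-filter (λ i h → θ i ≤? row a i h) (a ≥[ b ])
          (λ h₁ h₂ → Sat-point-above h₁ h₂ a b θ b≤Θ) satΓ)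
        refutesˡ
      (no b≰Θ) → pairPoints-survive r (λ i → atMost (row a i) (θ i) (C i))
        (λ i → UniqueP.filter⁺ _ (unique i))
        (λ i → ℕP.≤-trans (size-mono (ℕP.m≤n⊔m (depth l) (depth r))) (proj₁ (proj₂ (split i))))
        (PairPointsSatisfy-filter (λ i h → row a i h ≤? θ i) (negIneq a b)
          (λ h₁ h₂ below₁ below₂ → Sat-point-above h₁ h₂ (λ v → - a v) (+ 1 - b) (λ i → - θ i) (1-b≤-Θ b≰Θ)
            (λ i → ℤP.neg-mono-≤ (below₁ i)) (λ i → ℤP.neg-mono-≤ (below₂ i)))
          satΓ)
        refutesʳ
    where
    D : ℕ
    D = depth l ⊔ depth r
    split : ∀ i → ∃[ θ ] 2 ^ suc D ℕ.≤ length (atMost (row a i) θ (C i))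
                       × 2 ^ suc D ℕ.≤ length (atLeast (row a i) θ (C i))
    split i = median-split (row a i) (2 ^ suc D) (ℕP.m^n>0 2 (suc D)) (C i) (big i)
    θ : Fin m → ℤ
    θ i = proj₁ (split i)
    size-mono : ∀ {d} → d ℕ.≤ D → 2 ^ suc d ℕ.≤ 2 ^ suc D
    size-mono d≤D = ℕP.^-monoʳ-≤ 2 (s≤s d≤D)
    1-b≤-Θ : ¬ b ≤ sum θ → + 1 - b ≤ ∑[ i < m ] (- θ i)
    1-b≤-Θ b≰Θ = begin
      + 1 - b                ≤⟨ ℤP.+-monoʳ-≤ (+ 1) (ℤP.neg-mono-≤ (ℤP.i<j⇒suc[i]≤j (ℤP.≰⇒> b≰Θ))) ⟩
      + 1 - ℤ.suc (sum θ)    ≡⟨ cancel (sum θ) ⟩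
      - sum θ                ≡⟨ ∑-neg θ ⟨
      ∑[ i < m ] (- θ i)     ∎
      where
      open ℤP.≤-Reasoning
      cancel : ∀ x → + 1 - (1ℤ + x) ≡ - x
      cancel = solve-∀

  refutation-depth : ∀ T → IsSPRefutation (PHP m n) T → n ℕ.< 2 ^ suc (depth T)
  refutation-depth T refutes = ℕP.≰⇒> λ big →
    pairPoints-survive T (λ _ → allFin n) (λ _ → UniqueP.allFin⁺ n)
      (λ _ → subst (2 ^ suc (depth T) ℕ.≤_) (sym (ListP.length-tabulate (λ h → h))) big)
      (λ _ _ _ _ → []) refutes

⌊log₂⌋≤2*-of-<2^suc : ∀ {n} D → 2 ℕ.≤ n → n ℕ.< 2 ^ suc D → ⌊log₂ n ⌋ ℕ.≤ 2 ℕ.* D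
⌊log₂⌋≤2*-of-<2^suc zero    2≤n n<2 = contradiction n<2 (ℕP.≤⇒≯ 2≤n)
⌊log₂⌋≤2*-of-<2^suc {n} (suc D) _ n<2^[2+D] = begin
  ⌊log₂ n ⌋                  ≤⟨ ⌊log₂⌋-mono-≤ (ℕP.<⇒≤ n<2^[2+D]) ⟩
  ⌊log₂ (2 ^ suc (suc D)) ⌋  ≡⟨ ⌊log₂[2^n]⌋≡n (suc (suc D)) ⟩
  suc (suc D)                ≤⟨ s≤s (ℕP.m≤n+m (suc D) D) ⟩
  suc D ℕ.+ suc D            ≡⟨ cong (suc D ℕ.+_) (ℕP.+-identityʳ (suc D)) ⟨
  2 ℕ.* suc D                ∎
  where open ℕP.≤-Reasoning

-- The bound holds for PHP^m_n with any number m of pigeons.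
mainTheorem3 : ∀ (d : ℕ) → d ℕ.≥ 1 →
    ∃₂ λ (C n₀ : ℕ) → ∀ (n : ℕ) → n ℕ.≥ n₀ →
    (T : SPTree ((n ℕ.+ d) ℕ.* n)) → IsSPRefutation (PHP (n ℕ.+ d) n) T →
    ⌊log₂ n ⌋ ℕ.≤ C ℕ.* depth T
mainTheorem3 d _ = 2 , 2 , λ n 2≤n T refutes →
  ⌊log₂⌋≤2*-of-<2^suc (depth T) 2≤n (refutation-depth T refutes)
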